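{- Let $n\ge 2$, let $S\in\mathcal S_{n-1}$ have $r_{n-1}=r_{n-1}(S)$ rows indexed by $\alpha/\gamma$, and let $T$ be chosen uniformly at random among the extensions of $S$ to a staircase tableau of size $n$; let $r=r_n(T)$. Then $$\mathsf P(r=r_{n-1}+1)=\frac{1}{2\cdot 3^{r_{n-1}}},$$ and for $k=0,1,\dots,r_{n-1}$, $$\mathsf P(r=r_{n-1}-k)=\frac{2^{k+1}\left(2\binom{r_{n-1}}{k+1}+\binom{r_{n-1}}{k}\right)}{4\cdot 3^{r_{n-1}}}.$$
   Context: A staircase tableau of size $n$ is a Young diagram of shape $(n,n-1,\dots,2,1)$ (English convention: rows left-justified, the $i$-th row from the top has $n-i+1$ boxes, so the leftmost column has $n$ boxes) whose boxes are filled according to the rules: each box is either empty or contains one of the letters $\alpha,\beta,\gamma,\delta$; no box on the diagonal (the rightmost box of each row) is empty; all boxes in the same row and to the left of a $\beta$ or a $\delta$ are empty; all boxes in the same column and above an $\alpha$ or a $\gamma$ are empty. $\mathcal S_n$ is the set of staircase tableaux of size $n$. A row is called an $\alpha/\gamma$ row if its leftmost nonempty box contains $\alpha$ or $\gamma$; $r_n(S)$ denotes the number of $\alpha/\gamma$ rows of $S\in\mathcal S_n$. Deleting the leftmost column of a tableau $T\in\mathcal S_n$ yields a staircase tableau of size $n-1$; $T$ is called an extension of that tableau. Here $\binom{a}{b}=0$ when $b>a$. -}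

module Defs where

open import Data.Nat using (ℕ; zero; suc; _∸_; _+_)
open import Data.Bool using (Bool; true; false; _∧_; _∨_; not; if_then_else_)
open import Data.List using (List; []; _∷_; map; upTo; concatMap; filterᵇ; length)
open import Data.Vec using (Vec; []; _∷_)
open import Data.Maybe using (Maybe; just; nothing)

data Cell : Set where
  empty α β γ δ : Cell

isEmpty : Cell → Bool
isEmpty empty = true
isEmpty _     = false

isβδ : Cell → Bool
isβδ β = true
isβδ δ = true
isβδ _ = false

isαγ : Cell → Bool
isαγ α = true
isαγ γ = true
isαγ _ = false

-- A filling of the staircase Young diagram (n, n-1, ..., 1), stored column by
-- column from left to right.  In a filling of size n the leftmost column has
-- n boxes (rows 0..n-1, listed top to bottom), and the remaining columns form
-- a filling of size n-1 (with the same row indexing).  Hence  c ∷ S  is the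
-- filling whose leftmost column is c and which becomes S after deleting the
-- leftmost column.
data Filling : ℕ → Set where
  []  : Filling zero
  _∷_ : ∀ {n} → Vec Cell (suc n) → Filling n → Filling (suc n)

lookupCol : ∀ {k} → Vec Cell k → ℕ → Cell
lookupCol []       _       = empty
lookupCol (x ∷ xs) zero    = x
lookupCol (x ∷ xs) (suc i) = lookupCol xs i

-- entry T i j : content of the box in row i, column j (0-indexed, from the
-- top-left corner); boxes outside the diagram read as empty.
entry : ∀ {n} → Filling n → ℕ → ℕ → Cell
entry []      i j       = empty
entry (c ∷ S) i zero    = lookupCol c i
entry (c ∷ S) i (suc j) = entry S i j

all : {A : Set} → (A → Bool) → List A → Bool
all p []       = true
all p (x ∷ xs) = p x ∧ all p xs

-- Boxes of a size-n diagram: row i (i < n) has columns j < n - i;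
-- the diagonal box of row i is in column n - 1 - i.
boxOK : ∀ {n} → Filling n → ℕ → ℕ → Bool
boxOK T i j =
  (if isβδ (entry T i j) then all (λ j' → isEmpty (entry T i j')) (upTo j) else true)
  ∧ (if isαγ (entry T i j) then all (λ i' → isEmpty (entry T i' j)) (upTo i) else true)

isStaircase : ∀ {n} → Filling n → Bool
isStaircase {n} T =
  all (λ i → not (isEmpty (entry T i (n ∸ suc i)))
             ∧ all (λ j → boxOK T i j) (upTo (n ∸ i)))
      (upTo n)

row : ∀ {n} → Filling n → ℕ → List Cell
row {n} T i = map (entry T i) (upTo (n ∸ i))

leftmostNonempty : List Cell → Maybe Cell
leftmostNonempty []       = nothing
leftmostNonempty (x ∷ xs) = if isEmpty x then leftmostNonempty xs else just x

isαγRow : List Cell → Bool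
isαγRow xs with leftmostNonempty xs
... | just c  = isαγ c
... | nothing = false

count : {A : Set} → (A → Bool) → List A → ℕ
count p xs = length (filterᵇ p xs)

r : ∀ {n} → Filling n → ℕ
r {n} T = count (λ i → isαγRow (row T i)) (upTo n)

allCells : List Cell
allCells = empty ∷ α ∷ β ∷ γ ∷ δ ∷ []

allCols : (k : ℕ) → List (Vec Cell k)
allCols zero    = [] ∷ []
allCols (suc k) = concatMap (λ x → map (x ∷_) (allCols k)) allCells

extensions : ∀ {m} → Filling m → List (Filling (suc m))
extensions {m} S = filterᵇ isStaircase (map (_∷ S) (allCols (suc m)))

-- Only the new leftmost column c varies among the extensions of S.  A β/δ row of S forces
-- its new box to be empty; in an α/γ row the new box may stay empty (the row stays α/γ),
-- hold β or δ (the row turns β/δ), or hold α or γ, which needs every box of c above it to be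
-- empty; the new bottom box is nonempty and forms a row of its own.  Scanning c from the top,
-- once an α or γ has been placed each α/γ row of S contributes a factor 2 + x to the
-- generating polynomial of the number of α/γ rows and the bottom box a factor 2; before that
-- the polynomial is (1 + x) times this blocked one.  So among the 4·3^p extensions, p = r(S),
-- the number of α/γ rows has generating polynomial 2(1 + x)(2 + x)^p, whose coefficients are
-- the stated counts.
module Submission where

open import Defs
open import Data.Nat using (ℕ; zero; suc; _+_; _*_; _∸_; _^_; _≤_; _<_; _≡ᵇ_; z≤n; s≤s)
open import Data.Nat.Properties
open import Data.Nat.Combinatorics using (_C_; nCk≡nC[n∸k]; nCn≡1; k>n⇒nCk≡0; nCk+nC[k+1]≡[n+1]C[k+1])
open import Data.Nat.Tactic.RingSolver using (solve-∀)
open import Data.Bool using (Bool; true; false; _∧_; _∨_; not; if_then_else_; T?)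
open import Data.Bool.Properties using (∧-assoc; ∧-zeroʳ; ∧-identityʳ; ∧-idem; ∧-conicalˡ; ∧-conicalʳ; not-injective)
open import Data.List using (List; []; _∷_; length; map; applyUpTo; upTo; filterᵇ; _++_; concatMap)
open import Data.Nat.ListAction using (sum)
open import Data.Bool.ListAction using (and; or)
open import Data.List.Properties using (filter-++; length-++; map-cong; map-upTo)
open import Data.Vec using (Vec; []; _∷_)
open import Data.Product using (_×_; _,_)
open import Function using (_∘_)
open import Relation.Nullary using (contradiction)
open import Relation.Binary.PropositionalEquality

boolToℕ : Bool → ℕ
boolToℕ true  = 1
boolToℕ false = 0

trues : ∀ {m} → Vec Bool m → ℕ
trues []      = 0
trues (f ∷ F) = boolToℕ f + trues F

module _ {A : Set} where

  count-∷ : ∀ (p : A → Bool) x xs → count p (x ∷ xs) ≡ boolToℕ (p x) + count p xs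
  count-∷ p x xs with p x
  ... | true  = refl
  ... | false = refl

  count-++ : ∀ (p : A → Bool) xs ys → count p (xs ++ ys) ≡ count p xs + count p ys
  count-++ p xs ys = trans (cong length (filter-++ (T? ∘ p) xs ys)) (length-++ (filterᵇ p xs))

  count-cong : ∀ {p q : A → Bool} → (∀ x → p x ≡ q x) → ∀ xs → count p xs ≡ count q xs
  count-cong p≗q []       = refl
  count-cong {p} {q} p≗q (x ∷ xs) = begin
    count p (x ∷ xs)            ≡⟨ count-∷ p x xs ⟩
    boolToℕ (p x) + count p xs  ≡⟨ cong₂ _+_ (cong boolToℕ (p≗q x)) (count-cong p≗q xs) ⟩
    boolToℕ (q x) + count q xs  ≡⟨ count-∷ q x xs ⟨
    count q (x ∷ xs)            ∎
    where open ≡-Reasoning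

  count-false : ∀ xs → count (λ (_ : A) → false) xs ≡ 0
  count-false []       = refl
  count-false (x ∷ xs) = count-false xs

  count-true : ∀ xs → count (λ (_ : A) → true) xs ≡ length xs
  count-true []       = refl
  count-true (x ∷ xs) = cong suc (count-true xs)

  count-filterᵇ : ∀ (p q : A → Bool) xs → count q (filterᵇ p xs) ≡ count (λ x → p x ∧ q x) xs
  count-filterᵇ p q []       = refl
  count-filterᵇ p q (x ∷ xs) = trans head (sym (count-∷ (λ y → p y ∧ q y) x xs))
    where
    head : count q (filterᵇ p (x ∷ xs)) ≡ boolToℕ (p x ∧ q x) + count (λ y → p y ∧ q y) xs
    head with p x
    ... | true  = trans (count-∷ q x _) (cong (boolToℕ (q x) +_) (count-filterᵇ p q xs))
    ... | false = count-filterᵇ p q xs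

module _ {A B : Set} where

  count-map : ∀ (p : B → Bool) (f : A → B) xs → count p (map f xs) ≡ count (p ∘ f) xs
  count-map p f []       = refl
  count-map p f (x ∷ xs) = trans (count-∷ p (f x) (map f xs))
    (trans (cong (boolToℕ (p (f x)) +_) (count-map p f xs)) (sym (count-∷ (p ∘ f) x xs)))

  count-concatMap : ∀ (p : B → Bool) (g : A → List B) xs →
    count p (concatMap g xs) ≡ sum (map (count p ∘ g) xs)
  count-concatMap p g []       = refl
  count-concatMap p g (x ∷ xs) =
    trans (count-++ p (g x) (concatMap g xs)) (cong (count p (g x) +_) (count-concatMap p g xs))

tabulateℕ : {A : Set} → (ℕ → A) → (n : ℕ) → Vec A n
tabulateℕ f zero    = []
tabulateℕ f (suc n) = f 0 ∷ tabulateℕ (f ∘ suc) n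

tabulateℕ-cong : ∀ {A : Set} {f g : ℕ → A} n → (∀ i → i < n → f i ≡ g i) →
  tabulateℕ f n ≡ tabulateℕ g n
tabulateℕ-cong zero    f≗g = refl
tabulateℕ-cong (suc n) f≗g =
  cong₂ _∷_ (f≗g 0 (s≤s z≤n)) (tabulateℕ-cong n (λ i i<n → f≗g (suc i) (s≤s i<n)))

count-applyUpTo : ∀ {A : Set} (p : A → Bool) f n → count p (applyUpTo f n) ≡ trues (tabulateℕ (p ∘ f) n)
count-applyUpTo p f zero    = refl
count-applyUpTo p f (suc n) =
  trans (count-∷ p (f 0) _) (cong (boolToℕ (p (f 0)) +_) (count-applyUpTo p (f ∘ suc) n))

all≡and∘map : ∀ {A : Set} (p : A → Bool) xs → all p xs ≡ and (map p xs)
all≡and∘map p []       = refl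
all≡and∘map p (x ∷ xs) = cong (p x ∧_) (all≡and∘map p xs)

all-upTo : ∀ p n → all p (upTo n) ≡ and (applyUpTo p n)
all-upTo p n = trans (all≡and∘map p (upTo n)) (cong and (map-upTo p n))

and-applyUpTo-cong : ∀ {P Q : ℕ → Bool} n → (∀ i → i < n → P i ≡ Q i) →
  and (applyUpTo P n) ≡ and (applyUpTo Q n)
and-applyUpTo-cong zero    P≗Q = refl
and-applyUpTo-cong (suc n) P≗Q =
  cong₂ _∧_ (P≗Q 0 (s≤s z≤n)) (and-applyUpTo-cong n (λ i i<n → P≗Q (suc i) (s≤s i<n)))

and-applyUpTo-true : ∀ {P : ℕ → Bool} n → and (applyUpTo P n) ≡ true → ∀ i → i < n → P i ≡ true
and-applyUpTo-true {P} (suc n) allP zero    _         = ∧-conicalˡ (P 0) _ allP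
and-applyUpTo-true {P} (suc n) allP (suc i) (s≤s i<n) = and-applyUpTo-true n (∧-conicalʳ (P 0) _ allP) i i<n

and-applyUpTo-intro : ∀ {P : ℕ → Bool} n → (∀ i → i < n → P i ≡ true) → and (applyUpTo P n) ≡ true
and-applyUpTo-intro zero    allP = refl
and-applyUpTo-intro (suc n) allP =
  cong₂ _∧_ (allP 0 (s≤s z≤n)) (and-applyUpTo-intro n (λ i i<n → allP (suc i) (s≤s i<n)))

and-applyUpTo-∷ʳ : ∀ (P : ℕ → Bool) n → and (applyUpTo P (suc n)) ≡ and (applyUpTo P n) ∧ P n
and-applyUpTo-∷ʳ P zero    = ∧-identityʳ (P 0)
and-applyUpTo-∷ʳ P (suc n) =
  trans (cong (P 0 ∧_) (and-applyUpTo-∷ʳ (P ∘ suc) n)) (sym (∧-assoc (P 0) _ _))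

and-applyUpTo-if : ∀ (B : ℕ → Bool) e n →
  and (applyUpTo (λ j → if B j then e else true) n) ≡ (if or (applyUpTo B n) then e else true)
and-applyUpTo-if B e zero    = refl
and-applyUpTo-if B e (suc n) =
  trans (cong ((if B 0 then e else true) ∧_) (and-applyUpTo-if (B ∘ suc) e n)) (merge (B 0) _)
  where
  merge : ∀ b c → (if b then e else true) ∧ (if c then e else true) ≡ (if b ∨ c then e else true)
  merge false c     = refl
  merge true  true  = ∧-idem e
  merge true  false = ∧-identityʳ e

and-not⇒or-false : ∀ n (B : ℕ → Bool) →
  and (applyUpTo (λ j → if B j then false else true) n) ≡ true → or (applyUpTo B n) ≡ false
and-not⇒or-false n B noB with or (applyUpTo B n) | trans (sym (and-applyUpTo-if B false n)) noB
... | false | _ = refl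

nC0≡1 : ∀ n → n C 0 ≡ 1
nC0≡1 n = trans (nCk≡nC[n∸k] {0} {n} z≤n) (nCn≡1 n)

C-complement : ∀ k t → (k + t) C t ≡ (k + t) C k
C-complement k t = trans (nCk≡nC[n∸k] (m≤n+m t k)) (cong ((k + t) C_) (m+n∸n≡m k t))

-- Admissible columns

-- admissible F clear c: the column c can be put in front of a staircase tableau whose rows
-- have the α/γ flags F, giving one more row (the bottom box of c); clear records that no α or
-- γ occurs in c above the current box.  rank F c is the number of α/γ rows of the result.

αγAllowed : Bool → Cell → Bool
αγAllowed clear x = if isαγ x then clear else true

rowAdmits : Bool → Cell → Bool
rowAdmits f x = f ∨ isEmpty x

newRowIsαγ : Bool → Cell → Bool
newRowIsαγ f x = if isEmpty x then f else isαγ x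

admissible : ∀ {m} → Vec Bool m → Bool → Vec Cell (suc m) → Bool
admissible []      clear (x ∷ []) = not (isEmpty x) ∧ αγAllowed clear x
admissible (f ∷ F) clear (x ∷ c)  =
  αγAllowed clear x ∧ (rowAdmits f x ∧ admissible F (clear ∧ isEmpty x) c)

rank : ∀ {m} → Vec Bool m → Vec Cell (suc m) → ℕ
rank []      (x ∷ []) = boolToℕ (isαγ x)
rank (f ∷ F) (x ∷ c)  = boolToℕ (newRowIsαγ f x) + rank F c

columnCount : ∀ {m} → Vec Bool m → Bool → (ℕ → Bool) → ℕ
columnCount {m} F clear Q = count (λ c → admissible F clear c ∧ Q (rank F c)) (allCols (suc m))

count-allCols : ∀ k (p : Vec Cell (suc k) → Bool) →
  count p (allCols (suc k)) ≡ sum (map (λ x → count (p ∘ (x ∷_)) (allCols k)) allCells)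
count-allCols k p = trans (count-concatMap p (λ x → map (x ∷_) (allCols k)) allCells)
  (cong sum (map-cong (λ x → count-map p (x ∷_) (allCols k)) allCells))

count-allCols-1 : ∀ (p : Vec Cell 1 → Bool) →
  count p (allCols 1) ≡ sum (map (λ x → boolToℕ (p (x ∷ []))) allCells)
count-allCols-1 p = trans (count-allCols 0 p)
  (cong sum (map-cong (λ x → trans (count-∷ (p ∘ (x ∷_)) [] []) (+-identityʳ _)) allCells))

columnCount-[] : ∀ clear Q →
  columnCount [] clear Q ≡ 2 * boolToℕ (clear ∧ Q 1) + 2 * boolToℕ (Q 0)
columnCount-[] clear Q =
  trans (count-allCols-1 (λ c → admissible [] clear c ∧ Q (rank [] c)))
        (twice (boolToℕ (clear ∧ Q 1)) (boolToℕ (Q 0)))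
  where
  twice : ∀ a b → 0 + (a + (b + (a + (b + 0)))) ≡ 2 * a + 2 * b
  twice = solve-∀

-- The five summands produced by count-allCols belong to the new boxes empty, α, β, γ, δ.
module _ {m} (F : Vec Bool m) (Q : ℕ → Bool) where

  private
    noColumns : count (λ (_ : Vec Cell (suc m)) → false) (allCols (suc m)) ≡ 0
    noColumns = count-false (allCols (suc m))

    onlyEmpty : ∀ a z → z ≡ 0 → a + (z + (z + (z + (z + 0)))) ≡ a
    onlyEmpty a _ refl = +-identityʳ a

  columnCount-true∷-clear : columnCount (true ∷ F) true Q ≡
    columnCount F true (Q ∘ suc) + 2 * columnCount F false (Q ∘ suc) + 2 * columnCount F false Q
  columnCount-true∷-clear = trans (count-allCols (suc m) _)
    (collect (columnCount F true (Q ∘ suc)) (columnCount F false (Q ∘ suc)) (columnCount F false Q))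
    where
    collect : ∀ a b c → a + (b + (c + (b + (c + 0)))) ≡ a + 2 * b + 2 * c
    collect = solve-∀

  columnCount-true∷-blocked : columnCount (true ∷ F) false Q ≡
    columnCount F false (Q ∘ suc) + 2 * columnCount F false Q
  columnCount-true∷-blocked = trans (count-allCols (suc m) _)
    (collect (columnCount F false (Q ∘ suc)) (columnCount F false Q) _ noColumns)
    where
    collect : ∀ a c z → z ≡ 0 → a + (z + (c + (z + (c + 0)))) ≡ a + 2 * c
    collect a c _ refl = refl

  columnCount-false∷ : ∀ clear → columnCount (false ∷ F) clear Q ≡ columnCount F clear Q
  columnCount-false∷ true  = trans (count-allCols (suc m) _) (onlyEmpty (columnCount F true Q) _ noColumns)
  columnCount-false∷ false = trans (count-allCols (suc m) _) (onlyEmpty (columnCount F false Q) _ noColumns)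

columnCount-none : ∀ {m} (F : Vec Bool m) clear → columnCount F clear (λ _ → false) ≡ 0
columnCount-none {m} F clear =
  trans (count-cong (λ c → ∧-zeroʳ (admissible F clear c)) (allCols (suc m))) (count-false (allCols (suc m)))

columnCount-blocked-total : ∀ {m} (F : Vec Bool m) → columnCount F false (λ _ → true) ≡ 2 * 3 ^ trues F
columnCount-blocked-total []        = columnCount-[] false (λ _ → true)
columnCount-blocked-total (true ∷ F) = begin
  columnCount (true ∷ F) false (λ _ → true)   ≡⟨ columnCount-true∷-blocked F (λ _ → true) ⟩
  total + 2 * total                           ≡⟨ cong (λ t → t + 2 * t) (columnCount-blocked-total F) ⟩
  2 * 3 ^ p + 2 * (2 * 3 ^ p)                 ≡⟨ triple (3 ^ p) ⟩
  2 * 3 ^ suc p                               ∎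
  where
  open ≡-Reasoning
  p = trues F
  total = columnCount F false (λ _ → true)
  triple : ∀ x → 2 * x + 2 * (2 * x) ≡ 2 * (3 * x)
  triple = solve-∀
columnCount-blocked-total (false ∷ F) =
  trans (columnCount-false∷ F (λ _ → true) false) (columnCount-blocked-total F)

-- On generating polynomials: clear columns give (1 + x) times the blocked ones.
columnCount-clear : ∀ {m} (F : Vec Bool m) Q →
  columnCount F true Q ≡ columnCount F false Q + columnCount F false (Q ∘ suc)
columnCount-clear [] Q = begin
  columnCount [] true Q
    ≡⟨ columnCount-[] true Q ⟩
  2 * boolToℕ (Q 1) + 2 * boolToℕ (Q 0)
    ≡⟨ +-comm (2 * boolToℕ (Q 1)) _ ⟩
  2 * boolToℕ (Q 0) + 2 * boolToℕ (Q 1)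
    ≡⟨ cong₂ _+_ (columnCount-[] false Q) (columnCount-[] false (Q ∘ suc)) ⟨
  columnCount [] false Q + columnCount [] false (Q ∘ suc) ∎
  where open ≡-Reasoning
columnCount-clear (true ∷ F) Q = begin
  columnCount (true ∷ F) true Q
    ≡⟨ columnCount-true∷-clear F Q ⟩
  columnCount F true (Q ∘ suc) + 2 * a + 2 * c
    ≡⟨ cong (λ t → t + 2 * a + 2 * c) (columnCount-clear F (Q ∘ suc)) ⟩
  a + b + 2 * a + 2 * c
    ≡⟨ regroup a b c ⟩
  (a + 2 * c) + (b + 2 * a)
    ≡⟨ cong₂ _+_ (columnCount-true∷-blocked F Q) (columnCount-true∷-blocked F (Q ∘ suc)) ⟨
  columnCount (true ∷ F) false Q + columnCount (true ∷ F) false (Q ∘ suc) ∎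
  where
  open ≡-Reasoning
  a = columnCount F false (Q ∘ suc)
  b = columnCount F false (Q ∘ suc ∘ suc)
  c = columnCount F false Q
  regroup : ∀ a b c → a + b + 2 * a + 2 * c ≡ (a + 2 * c) + (b + 2 * a)
  regroup = solve-∀
columnCount-clear (false ∷ F) Q = begin
  columnCount (false ∷ F) true Q
    ≡⟨ columnCount-false∷ F Q true ⟩
  columnCount F true Q
    ≡⟨ columnCount-clear F Q ⟩
  columnCount F false Q + columnCount F false (Q ∘ suc)
    ≡⟨ cong₂ _+_ (columnCount-false∷ F Q false) (columnCount-false∷ F (Q ∘ suc) false) ⟨
  columnCount (false ∷ F) false Q + columnCount (false ∷ F) false (Q ∘ suc) ∎
  where open ≡-Reasoning

-- Multiplied by 2 ^ t to avoid the truncated exponent p ∸ t.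
columnCount-blocked-binomial : ∀ {m} (F : Vec Bool m) t →
  columnCount F false (_≡ᵇ t) * 2 ^ t ≡ 2 * (trues F C t) * 2 ^ trues F
columnCount-blocked-binomial []      zero    = refl
columnCount-blocked-binomial []      (suc t) = refl
columnCount-blocked-binomial (false ∷ F) t =
  trans (cong (_* 2 ^ t) (columnCount-false∷ F (_≡ᵇ t) false)) (columnCount-blocked-binomial F t)
columnCount-blocked-binomial (true ∷ F) zero = begin
  columnCount (true ∷ F) false (_≡ᵇ 0) * 1
    ≡⟨ cong (_* 1) (columnCount-true∷-blocked F (_≡ᵇ 0)) ⟩
  (columnCount F false (λ _ → false) + 2 * a) * 1
    ≡⟨ cong (λ z → (z + 2 * a) * 1) (columnCount-none F false) ⟩
  2 * a * 1
    ≡⟨ *-assoc 2 a 1 ⟩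
  2 * (a * 1)
    ≡⟨ cong (2 *_) (columnCount-blocked-binomial F 0) ⟩
  2 * (2 * (p C 0) * 2 ^ p)
    ≡⟨ cong (λ c → 2 * (2 * c * 2 ^ p)) (nC0≡1 p) ⟩
  2 * (2 * 1 * 2 ^ p)
    ≡⟨ shift (2 ^ p) ⟩
  2 * 1 * 2 ^ suc p
    ≡⟨ cong (λ c → 2 * c * 2 ^ suc p) (nC0≡1 (suc p)) ⟨
  2 * (suc p C 0) * 2 ^ suc p ∎
  where
  open ≡-Reasoning
  p = trues F
  a = columnCount F false (_≡ᵇ 0)
  shift : ∀ x → 2 * (2 * 1 * x) ≡ 2 * 1 * (2 * x)
  shift = solve-∀
columnCount-blocked-binomial (true ∷ F) (suc t) = begin
  columnCount (true ∷ F) false (_≡ᵇ suc t) * 2 ^ suc t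
    ≡⟨ cong (_* 2 ^ suc t) (columnCount-true∷-blocked F (_≡ᵇ suc t)) ⟩
  (a + 2 * b) * 2 ^ suc t
    ≡⟨ distribute a b (2 ^ t) ⟩
  2 * (a * 2 ^ t) + 2 * (b * 2 ^ suc t)
    ≡⟨ cong₂ (λ x y → 2 * x + 2 * y)
             (columnCount-blocked-binomial F t) (columnCount-blocked-binomial F (suc t)) ⟩
  2 * (2 * (p C t) * 2 ^ p) + 2 * (2 * (p C suc t) * 2 ^ p)
    ≡⟨ collect (p C t) (p C suc t) (2 ^ p) ⟩
  2 * (p C t + p C suc t) * 2 ^ suc p
    ≡⟨ cong (λ c → 2 * c * 2 ^ suc p) (nCk+nC[k+1]≡[n+1]C[k+1] p t) ⟩
  2 * (suc p C suc t) * 2 ^ suc p ∎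
  where
  open ≡-Reasoning
  p = trues F
  a = columnCount F false (_≡ᵇ t)
  b = columnCount F false (_≡ᵇ suc t)
  distribute : ∀ a b x → (a + 2 * b) * (2 * x) ≡ 2 * (a * x) + 2 * (b * (2 * x))
  distribute = solve-∀
  collect : ∀ c d x → 2 * (2 * c * x) + 2 * (2 * d * x) ≡ 2 * (c + d) * (2 * x)
  collect = solve-∀

module _ {m} (F : Vec Bool m) where

  private
    p : ℕ
    p = trues F

  columnCount-blocked-at : ∀ k t → k + t ≡ p → columnCount F false (_≡ᵇ t) ≡ 2 * (p C k) * 2 ^ k
  columnCount-blocked-at k t k+t≡p = *-cancelʳ-≡ _ _ (2 ^ t) {{m^n≢0 2 t}} (begin
    columnCount F false (_≡ᵇ t) * 2 ^ t
      ≡⟨ columnCount-blocked-binomial F t ⟩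
    2 * (p C t) * 2 ^ p
      ≡⟨ cong (λ n → 2 * (n C t) * 2 ^ n) k+t≡p ⟨
    2 * ((k + t) C t) * 2 ^ (k + t)
      ≡⟨ cong₂ (λ c x → 2 * c * x) (C-complement k t) (^-distribˡ-+-* 2 k t) ⟩
    2 * ((k + t) C k) * (2 ^ k * 2 ^ t)
      ≡⟨ *-assoc (2 * ((k + t) C k)) (2 ^ k) (2 ^ t) ⟨
    2 * ((k + t) C k) * 2 ^ k * 2 ^ t
      ≡⟨ cong (λ n → 2 * (n C k) * 2 ^ k * 2 ^ t) k+t≡p ⟩
    2 * (p C k) * 2 ^ k * 2 ^ t ∎)
    where open ≡-Reasoning

  columnCount-blocked-above : columnCount F false (_≡ᵇ suc p) ≡ 0
  columnCount-blocked-above = m*n≡0⇒m≡0 _ (2 ^ suc p) {{m^n≢0 2 (suc p)}}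
    (trans (columnCount-blocked-binomial F (suc p)) (cong (λ c → 2 * c * 2 ^ p) (k>n⇒nCk≡0 (n<1+n p))))

  columnCount-blocked-shifted : ∀ k d → k + d ≡ p →
    columnCount F false (λ v → suc v ≡ᵇ d) ≡ 2 * (p C suc k) * 2 ^ suc k
  columnCount-blocked-shifted k zero    k+0≡p = trans (columnCount-none F false)
    (cong (λ c → 2 * c * 2 ^ suc k) (sym (k>n⇒nCk≡0 (s≤s p≤k))))
    where
    p≤k : p ≤ k
    p≤k = ≤-reflexive (trans (sym k+0≡p) (+-identityʳ k))
  columnCount-blocked-shifted k (suc u) k+1+u≡p =
    columnCount-blocked-at (suc k) u (trans (sym (+-suc k u)) k+1+u≡p)

  columnCount-clear-at : ∀ k d → k + d ≡ p →
    columnCount F true (_≡ᵇ d) ≡ 2 ^ (k + 1) * (2 * (p C (k + 1)) + p C k)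
  columnCount-clear-at k d k+d≡p = begin
    columnCount F true (_≡ᵇ d)
      ≡⟨ columnCount-clear F (_≡ᵇ d) ⟩
    columnCount F false (_≡ᵇ d) + columnCount F false (λ v → suc v ≡ᵇ d)
      ≡⟨ cong₂ _+_ (columnCount-blocked-at k d k+d≡p) (columnCount-blocked-shifted k d k+d≡p) ⟩
    2 * (p C k) * 2 ^ k + 2 * (p C suc k) * 2 ^ suc k
      ≡⟨ collect (p C k) (p C suc k) (2 ^ k) ⟩
    2 ^ suc k * (2 * (p C suc k) + p C k)
      ≡⟨ cong (λ j → 2 ^ j * (2 * (p C j) + p C k)) (+-comm 1 k) ⟩
    2 ^ (k + 1) * (2 * (p C (k + 1)) + p C k) ∎
    where
    open ≡-Reasoning
    collect : ∀ a b x → 2 * a * x + 2 * b * (2 * x) ≡ 2 * x * (2 * b + a)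
    collect = solve-∀

  columnCount-clear-top : columnCount F true (_≡ᵇ suc p) ≡ 2
  columnCount-clear-top = begin
    columnCount F true (_≡ᵇ suc p)
      ≡⟨ columnCount-clear F (_≡ᵇ suc p) ⟩
    columnCount F false (_≡ᵇ suc p) + columnCount F false (_≡ᵇ p)
      ≡⟨ cong₂ _+_ columnCount-blocked-above (columnCount-blocked-at 0 p refl) ⟩
    2 * (p C 0) * 1
      ≡⟨ cong (λ c → 2 * c * 1) (nC0≡1 p) ⟩
    2 ∎
    where open ≡-Reasoning

  columnCount-clear-total : columnCount F true (λ _ → true) ≡ 4 * 3 ^ p
  columnCount-clear-total = begin
    columnCount F true (λ _ → true)
      ≡⟨ columnCount-clear F (λ _ → true) ⟩
    columnCount F false (λ _ → true) + columnCount F false (λ _ → true)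
      ≡⟨ cong (λ x → x + x) (columnCount-blocked-total F) ⟩
    2 * 3 ^ p + 2 * 3 ^ p
      ≡⟨ double (3 ^ p) ⟩
    4 * 3 ^ p ∎
    where
    open ≡-Reasoning
    double : ∀ x → 2 * x + 2 * x ≡ 4 * x
    double = solve-∀

isαγRow-∷ : ∀ x xs → isαγRow (x ∷ xs) ≡ newRowIsαγ (isαγRow xs) x
isαγRow-∷ empty xs = refl
isαγRow-∷ α     xs = refl
isαγRow-∷ β     xs = refl
isαγRow-∷ γ     xs = refl
isαγRow-∷ δ     xs = refl

someβδ≡not-isαγRow : ∀ k (g : ℕ → Cell) → isEmpty (g k) ≡ false →
  and (applyUpTo (λ j → if isβδ (g j) then and (applyUpTo (isEmpty ∘ g) j) else true) (suc k)) ≡ true →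
  or (applyUpTo (isβδ ∘ g) (suc k)) ≡ not (isαγRow (applyUpTo g (suc k)))
someβδ≡not-isαγRow zero g filled rule with g 0
... | empty = contradiction filled λ ()
... | α     = refl
... | β     = refl
... | γ     = refl
... | δ     = refl
someβδ≡not-isαγRow (suc k) g filled rule with g 0
... | empty = someβδ≡not-isαγRow k (g ∘ suc) filled (∧-conicalʳ true _ rule)
... | α     = and-not⇒or-false (suc k) (isβδ ∘ g ∘ suc) (∧-conicalʳ true _ rule)
... | β     = refl
... | γ     = and-not⇒or-false (suc k) (isβδ ∘ g ∘ suc) (∧-conicalʳ true _ rule)
... | δ     = refl

emptyAbove : ∀ {k} → Vec Cell k → ℕ → Bool
emptyAbove c i = and (applyUpTo (isEmpty ∘ lookupCol c) i)

admissibleRow : ∀ {k} → Bool → (ℕ → Bool) → Vec Cell k → ℕ → Bool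
admissibleRow clear G c i =
  αγAllowed (clear ∧ emptyAbove c i) (lookupCol c i) ∧ rowAdmits (G i) (lookupCol c i)

admissibleLast : ∀ {k} → Bool → Vec Cell k → ℕ → Bool
admissibleLast clear c i =
  not (isEmpty (lookupCol c i)) ∧ αγAllowed (clear ∧ emptyAbove c i) (lookupCol c i)

admissible-rowwise : ∀ m clear (G : ℕ → Bool) (c : Vec Cell (suc m)) →
  admissible (tabulateℕ G m) clear c ≡ and (applyUpTo (admissibleRow clear G c) m) ∧ admissibleLast clear c m
admissible-rowwise zero    clear G (x ∷ []) =
  cong (λ b → not (isEmpty x) ∧ αγAllowed b x) (sym (∧-identityʳ clear))
admissible-rowwise (suc m) clear G (x ∷ c)  = begin
  a ∧ (b ∧ admissible (tabulateℕ (G ∘ suc) m) clear′ c)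
    ≡⟨ cong (λ z → a ∧ (b ∧ z)) (admissible-rowwise m clear′ (G ∘ suc) c) ⟩
  a ∧ (b ∧ (and (applyUpTo (admissibleRow clear′ (G ∘ suc) c) m) ∧ admissibleLast clear′ c m))
    ≡⟨ trans (sym (∧-assoc a b _)) (sym (∧-assoc (a ∧ b) _ _)) ⟩
  ((a ∧ b) ∧ and (applyUpTo (admissibleRow clear′ (G ∘ suc) c) m)) ∧ admissibleLast clear′ c m
    ≡⟨ cong₂ (λ u v → ((αγAllowed u x ∧ b) ∧ v) ∧ admissibleLast clear′ c m)
             (sym (∧-identityʳ clear)) (and-applyUpTo-cong m (λ i _ → shiftRow i)) ⟩
  (admissibleRow clear G (x ∷ c) 0 ∧ and (applyUpTo (admissibleRow clear G (x ∷ c) ∘ suc) m))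
    ∧ admissibleLast clear′ c m
    ≡⟨ cong (λ e → and (applyUpTo (admissibleRow clear G (x ∷ c)) (suc m))
                   ∧ (not (isEmpty (lookupCol c m)) ∧ αγAllowed e (lookupCol c m))) (reassoc m) ⟩
  and (applyUpTo (admissibleRow clear G (x ∷ c)) (suc m)) ∧ admissibleLast clear (x ∷ c) (suc m) ∎
  where
  open ≡-Reasoning
  a = αγAllowed clear x
  b = rowAdmits (G 0) x
  clear′ = clear ∧ isEmpty x
  reassoc : ∀ i → clear′ ∧ emptyAbove c i ≡ clear ∧ emptyAbove (x ∷ c) (suc i)
  reassoc i = ∧-assoc clear (isEmpty x) (emptyAbove c i)
  shiftRow : ∀ i → admissibleRow clear′ (G ∘ suc) c i ≡ admissibleRow clear G (x ∷ c) (suc i)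
  shiftRow i = cong (λ e → αγAllowed e (lookupCol c i) ∧ rowAdmits (G (suc i)) (lookupCol c i)) (reassoc i)

rank-tabulate : ∀ m (G : ℕ → Bool) (c : Vec Cell (suc m)) → G m ≡ false →
  rank (tabulateℕ G m) c ≡ trues (tabulateℕ (λ i → newRowIsαγ (G i) (lookupCol c i)) (suc m))
rank-tabulate zero    G (x ∷ []) G0≡false rewrite G0≡false =
  sym (trans (+-identityʳ _) (cong boolToℕ (lonelyBox x)))
  where
  lonelyBox : ∀ x → newRowIsαγ false x ≡ isαγ x
  lonelyBox empty = refl
  lonelyBox α     = refl
  lonelyBox β     = refl
  lonelyBox γ     = refl
  lonelyBox δ     = refl
rank-tabulate (suc m) G (x ∷ c)  Gm≡false =
  cong (boolToℕ (newRowIsαγ (G 0) x) +_) (rank-tabulate m (G ∘ suc) c Gm≡false)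

-- Extensions of a staircase tableau

rowFlag : ∀ {m} → Filling m → ℕ → Bool
rowFlag S i = isαγRow (row S i)

rowFlags : ∀ {m} → Filling m → Vec Bool m
rowFlags {m} S = tabulateℕ (rowFlag S) m

staircaseRow : ∀ {n} → Filling n → ℕ → Bool
staircaseRow {n} T i = not (isEmpty (entry T i (n ∸ suc i))) ∧ all (boxOK T i) (upTo (n ∸ i))

r≡trues-rowFlags : ∀ {m} (S : Filling m) → r S ≡ trues (rowFlags S)
r≡trues-rowFlags {m} S = count-applyUpTo (rowFlag S) (λ i → i) m

rowFlag-bottom : ∀ {m} (S : Filling m) → rowFlag S m ≡ false
rowFlag-bottom {m} S = cong (λ n → isαγRow (map (entry S m) (upTo n))) (n∸n≡0 m)

module _ {m} (S : Filling m) (c : Vec Cell (suc m)) where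

  row-extension : ∀ {i} → i ≤ m → row (c ∷ S) i ≡ lookupCol c i ∷ row S i
  row-extension {i} i≤m = begin
    map (entry (c ∷ S) i) (upTo (suc m ∸ i))
      ≡⟨ map-upTo (entry (c ∷ S) i) (suc m ∸ i) ⟩
    applyUpTo (entry (c ∷ S) i) (suc m ∸ i)
      ≡⟨ cong (applyUpTo (entry (c ∷ S) i)) (+-∸-assoc 1 i≤m) ⟩
    lookupCol c i ∷ applyUpTo (entry S i) (m ∸ i)
      ≡⟨ cong (lookupCol c i ∷_) (map-upTo (entry S i) (m ∸ i)) ⟨
    lookupCol c i ∷ row S i ∎
    where open ≡-Reasoning

  r-extension : r (c ∷ S) ≡ rank (rowFlags S) c
  r-extension = begin
    r (c ∷ S)
      ≡⟨ r≡trues-rowFlags (c ∷ S) ⟩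
    trues (tabulateℕ (rowFlag (c ∷ S)) (suc m))
      ≡⟨ cong trues (tabulateℕ-cong (suc m) (λ i i≤m → rowFlag-extension (≤-pred i≤m))) ⟩
    trues (tabulateℕ (λ i → newRowIsαγ (rowFlag S i) (lookupCol c i)) (suc m))
      ≡⟨ rank-tabulate m (rowFlag S) c (rowFlag-bottom S) ⟨
    rank (rowFlags S) c ∎
    where
    open ≡-Reasoning
    rowFlag-extension : ∀ {i} → i ≤ m → rowFlag (c ∷ S) i ≡ newRowIsαγ (rowFlag S i) (lookupCol c i)
    rowFlag-extension {i} i≤m =
      trans (cong isαγRow (row-extension i≤m)) (isαγRow-∷ (lookupCol c i) (row S i))

  boxOK-left : ∀ i → boxOK (c ∷ S) i 0 ≡ αγAllowed (emptyAbove c i) (lookupCol c i)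
  boxOK-left i = cong₂ _∧_ (if-same (isβδ (lookupCol c i)))
    (cong (if isαγ (lookupCol c i) then_else true) (all-upTo (isEmpty ∘ lookupCol c) i))
    where
    if-same : ∀ b → (if b then true else true) ≡ true
    if-same true  = refl
    if-same false = refl

  boxOK-right : ∀ i j → boxOK S i j ≡ true →
    boxOK (c ∷ S) i (suc j) ≡ (if isβδ (entry S i j) then isEmpty (lookupCol c i) else true)
  boxOK-right i j ok = trans (cong (λ z → (if isβδ (entry S i j) then z else true) ∧ _) emptyLeft)
                             (dropSatisfied (isβδ (entry S i j)) _ _ ok)
    where
    emptyLeft : all (isEmpty ∘ entry (c ∷ S) i) (upTo (suc j))
              ≡ isEmpty (lookupCol c i) ∧ all (isEmpty ∘ entry S i) (upTo j)
    emptyLeft = trans (all-upTo (isEmpty ∘ entry (c ∷ S) i) (suc j))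
                      (cong (isEmpty (lookupCol c i) ∧_) (sym (all-upTo (isEmpty ∘ entry S i) j)))
    dropSatisfied : ∀ b {e} X A → (if b then X else true) ∧ A ≡ true →
      (if b then e ∧ X else true) ∧ A ≡ (if b then e else true)
    dropSatisfied true  {e} true true _ = trans (∧-identityʳ (e ∧ true)) (∧-identityʳ e)
    dropSatisfied false     X    true _ = refl

  staircaseRow-extension : ∀ {i} → i < m → staircaseRow S i ≡ true →
    staircaseRow (c ∷ S) i ≡ admissibleRow true (rowFlag S) c i
  staircaseRow-extension {i} i<m ok = begin
    not (isEmpty (entry (c ∷ S) i (m ∸ i))) ∧ all (boxOK (c ∷ S) i) (upTo (suc m ∸ i))
      ≡⟨ cong₂ (λ a n → not (isEmpty (entry (c ∷ S) i a)) ∧ all (boxOK (c ∷ S) i) (upTo n))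
               m∸i≡1+k (trans (+-∸-assoc 1 (<⇒≤ i<m)) (cong suc m∸i≡1+k)) ⟩
    not (isEmpty (entry S i k)) ∧ all (boxOK (c ∷ S) i) (upTo (suc (suc k)))
      ≡⟨ cong₂ _∧_ filled (all-upTo (boxOK (c ∷ S) i) (suc (suc k))) ⟩
    boxOK (c ∷ S) i 0 ∧ and (applyUpTo (boxOK (c ∷ S) i ∘ suc) (suc k))
      ≡⟨ cong₂ _∧_ (boxOK-left i) rowPart ⟩
    admissibleRow true (rowFlag S) c i ∎
    where
    open ≡-Reasoning
    k = m ∸ suc i
    x = lookupCol c i
    m∸i≡1+k : m ∸ i ≡ suc k
    m∸i≡1+k = +-∸-assoc 1 i<m
    filled : not (isEmpty (entry S i k)) ≡ true
    filled = ∧-conicalˡ _ _ ok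
    boxesS : and (applyUpTo (boxOK S i) (suc k)) ≡ true
    boxesS = trans (sym (all-upTo (boxOK S i) (suc k)))
                   (subst (λ n → all (boxOK S i) (upTo n) ≡ true) m∸i≡1+k (∧-conicalʳ _ _ ok))
    boxS : ∀ j → j < suc k → boxOK S i j ≡ true
    boxS = and-applyUpTo-true (suc k) boxesS
    βδRule : and (applyUpTo (λ j → if isβδ (entry S i j) then and (applyUpTo (isEmpty ∘ entry S i) j) else true)
                            (suc k)) ≡ true
    βδRule = and-applyUpTo-intro (suc k) λ j j<1+k →
      trans (cong (if isβδ (entry S i j) then_else true) (sym (all-upTo (isEmpty ∘ entry S i) j)))
            (∧-conicalˡ _ _ (boxS j j<1+k))
    rowFlag≡ : isαγRow (applyUpTo (entry S i) (suc k)) ≡ rowFlag S i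
    rowFlag≡ = cong isαγRow (sym (trans (map-upTo (entry S i) (m ∸ i))
                                        (cong (applyUpTo (entry S i)) m∸i≡1+k)))
    rowAdmits-if : ∀ f → (if not f then isEmpty x else true) ≡ rowAdmits f x
    rowAdmits-if true  = refl
    rowAdmits-if false = refl
    rowPart : and (applyUpTo (boxOK (c ∷ S) i ∘ suc) (suc k)) ≡ rowAdmits (rowFlag S i) x
    rowPart = begin
      and (applyUpTo (boxOK (c ∷ S) i ∘ suc) (suc k))
        ≡⟨ and-applyUpTo-cong (suc k) (λ j j<1+k → boxOK-right i j (boxS j j<1+k)) ⟩
      and (applyUpTo (λ j → if isβδ (entry S i j) then isEmpty x else true) (suc k))
        ≡⟨ and-applyUpTo-if (isβδ ∘ entry S i) (isEmpty x) (suc k) ⟩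
      (if or (applyUpTo (isβδ ∘ entry S i) (suc k)) then isEmpty x else true)
        ≡⟨ cong (if_then isEmpty x else true)
                (someβδ≡not-isαγRow k (entry S i) (not-injective filled) βδRule) ⟩
      (if not (isαγRow (applyUpTo (entry S i) (suc k))) then isEmpty x else true)
        ≡⟨ cong (λ f → if not f then isEmpty x else true) rowFlag≡ ⟩
      (if not (rowFlag S i) then isEmpty x else true)
        ≡⟨ rowAdmits-if (rowFlag S i) ⟩
      rowAdmits (rowFlag S i) x ∎

  staircaseRow-extension-bottom : staircaseRow (c ∷ S) m ≡ admissibleLast true c m
  staircaseRow-extension-bottom = begin
    not (isEmpty (entry (c ∷ S) m (m ∸ m))) ∧ all (boxOK (c ∷ S) m) (upTo (suc m ∸ m))
      ≡⟨ cong₂ (λ a n → not (isEmpty (entry (c ∷ S) m a)) ∧ all (boxOK (c ∷ S) m) (upTo n))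
               (n∸n≡0 m) (m+n∸n≡m 1 m) ⟩
    not (isEmpty (lookupCol c m)) ∧ (boxOK (c ∷ S) m 0 ∧ true)
      ≡⟨ cong (not (isEmpty (lookupCol c m)) ∧_) (trans (∧-identityʳ _) (boxOK-left m)) ⟩
    admissibleLast true c m ∎
    where open ≡-Reasoning

  isStaircase-extension : isStaircase S ≡ true → isStaircase (c ∷ S) ≡ admissible (rowFlags S) true c
  isStaircase-extension stair = begin
    isStaircase (c ∷ S)
      ≡⟨ all-upTo (staircaseRow (c ∷ S)) (suc m) ⟩
    and (applyUpTo (staircaseRow (c ∷ S)) (suc m))
      ≡⟨ and-applyUpTo-∷ʳ (staircaseRow (c ∷ S)) m ⟩
    and (applyUpTo (staircaseRow (c ∷ S)) m) ∧ staircaseRow (c ∷ S) m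
      ≡⟨ cong₂ _∧_ (and-applyUpTo-cong m λ i i<m → staircaseRow-extension i<m (rowsS i i<m))
                   staircaseRow-extension-bottom ⟩
    and (applyUpTo (admissibleRow true (rowFlag S) c) m) ∧ admissibleLast true c m
      ≡⟨ admissible-rowwise m true (rowFlag S) c ⟨
    admissible (rowFlags S) true c ∎
    where
    open ≡-Reasoning
    rowsS : ∀ i → i < m → staircaseRow S i ≡ true
    rowsS = and-applyUpTo-true m (trans (sym (all-upTo (staircaseRow S) m)) stair)

count-extensions : ∀ {m} (S : Filling m) → isStaircase S ≡ true → ∀ Q →
  count (Q ∘ r) (extensions S) ≡ columnCount (rowFlags S) true Q
count-extensions {m} S stair Q = begin
  count (Q ∘ r) (filterᵇ isStaircase (map (_∷ S) (allCols (suc m))))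
    ≡⟨ count-filterᵇ isStaircase (Q ∘ r) (map (_∷ S) (allCols (suc m))) ⟩
  count (λ T → isStaircase T ∧ Q (r T)) (map (_∷ S) (allCols (suc m)))
    ≡⟨ count-map (λ T → isStaircase T ∧ Q (r T)) (_∷ S) (allCols (suc m)) ⟩
  count (λ c → isStaircase (c ∷ S) ∧ Q (r (c ∷ S))) (allCols (suc m))
    ≡⟨ count-cong (λ c → cong₂ _∧_ (isStaircase-extension S c stair) (cong Q (r-extension S c)))
                  (allCols (suc m)) ⟩
  columnCount (rowFlags S) true Q ∎
  where open ≡-Reasoning

lemma2 : (m : ℕ) → 1 ≤ m → (S : Filling m) → isStaircase S ≡ true →
    (count (λ T → r T ≡ᵇ suc (r S)) (extensions S) * (2 * 3 ^ r S)
        ≡ length (extensions S))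
    × ((k : ℕ) → k ≤ r S →
        count (λ T → r T ≡ᵇ r S ∸ k) (extensions S) * (4 * 3 ^ r S)
          ≡ length (extensions S) * (2 ^ (k + 1) * (2 * (r S C (k + 1)) + r S C k)))
lemma2 m _ S stair rewrite r≡trues-rowFlags S = growth , decline
  where
  F = rowFlags S
  p = trues F
  #extensions : length (extensions S) ≡ 4 * 3 ^ p
  #extensions = trans (sym (count-true (extensions S)))
                      (trans (count-extensions S stair (λ _ → true)) (columnCount-clear-total F))
  growth : count (λ T → r T ≡ᵇ suc p) (extensions S) * (2 * 3 ^ p) ≡ length (extensions S)
  growth = begin
    count (λ T → r T ≡ᵇ suc p) (extensions S) * (2 * 3 ^ p)
      ≡⟨ cong (_* (2 * 3 ^ p)) (trans (count-extensions S stair (_≡ᵇ suc p)) (columnCount-clear-top F)) ⟩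
    2 * (2 * 3 ^ p)
      ≡⟨ *-assoc 2 2 (3 ^ p) ⟨
    4 * 3 ^ p
      ≡⟨ #extensions ⟨
    length (extensions S) ∎
    where open ≡-Reasoning
  decline : (k : ℕ) → k ≤ p → count (λ T → r T ≡ᵇ p ∸ k) (extensions S) * (4 * 3 ^ p)
                              ≡ length (extensions S) * (2 ^ (k + 1) * (2 * (p C (k + 1)) + p C k))
  decline k k≤p = begin
    count (λ T → r T ≡ᵇ p ∸ k) (extensions S) * (4 * 3 ^ p)
      ≡⟨ cong (_* (4 * 3 ^ p)) (trans (count-extensions S stair (_≡ᵇ p ∸ k))
                                      (columnCount-clear-at F k (p ∸ k) (m+[n∸m]≡n k≤p))) ⟩
    2 ^ (k + 1) * (2 * (p C (k + 1)) + p C k) * (4 * 3 ^ p)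
      ≡⟨ *-comm _ (4 * 3 ^ p) ⟩
    4 * 3 ^ p * (2 ^ (k + 1) * (2 * (p C (k + 1)) + p C k))
      ≡⟨ cong (_* (2 ^ (k + 1) * (2 * (p C (k + 1)) + p C k))) #extensions ⟨
    length (extensions S) * (2 ^ (k + 1) * (2 * (p C (k + 1)) + p C k)) ∎
    where open ≡-Reasoning
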